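{- Consider the algorithm $\mathcal A$ described in the context, run on a valid W$k$S-RSP input $(\sigma_1,\ell_1),\dots,(\sigma_T,\ell_T)$ with $\ell_1=k$. For $\ell\in\{1,\dots,k\}$ let $X^\ell$ and $Y^\ell$ be the number of forced movements and of unforced movements, respectively, of the algorithm's $\ell$-th server over all rounds. Then with probability one: (1) $X^\ell\le X^{\ell+1}+Y^{\ell+1}+|\mathcal I^\ell_T|$ for all $\ell\in\{1,\dots,k-1\}$; (2) $X^k\le|\mathcal I^k_T|$.
   Context: $U$ is a finite set (uniform metric). A hierarchical service pattern over $[1,s+1)$ is a $k$-tuple $\mathcal I=(\mathcal I^1,\dots,\mathcal I^k)$ of partitions of $[1,s+1)$ into left-closed right-open integer intervals with $\mathcal I^\ell$ refining $\mathcal I^{\ell+1}$; $|\mathcal I^\ell|$ is the number of intervals in level $\ell$. A labeling maps the multiset $\mathcal I^1\uplus\dots\uplus\mathcal I^k$ to $U$; it is feasible with respect to $(\sigma_1,\dots,\sigma_s)$ if each $r\le s$ lies in some interval labeled $\sigma_r$. The $\ell$-extension of a pattern $\mathcal I_{t-1}$ over $[1,t)$ adds $[t,t+1)$ as a new interval to each level $i\le\ell$ and extends the last interval of each level $i>\ell$ by $[t,t+1)$. A valid W$k$S-RSP input is a sequence of pairs $(\sigma_t,\ell_t)\in U\times\{0,\dots,k\}$ such that, with $\mathcal I_t$ the $\ell_t$-extension of $\mathcal I_{t-1}$, each $\mathcal I_t$ is feasible with respect to $\rho_t=(\sigma_1,\dots,\sigma_t)$. $L^i_t$ is the last interval of $\mathcal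 I^i_t$. $Q^\ell_t(p^{\ell+1},\dots,p^k)$ is the set of $p^\ell\in U$ such that some feasible labeling $\gamma$ of $\mathcal I_t$ w.r.t. $\rho_t$ has $\gamma(L^i_t)=p^i$ for all $i\in\{\ell,\dots,k\}$. Algorithm $\mathcal A$: $s^\ell_t$ denotes the position of its $\ell$-th server after round $t$. In round $t$: set flag $:=$ false; for $\ell=k,k-1,\dots,1$: compute $Q:=Q^\ell_t(s^{\ell+1}_t,\dots,s^k_t)$; if flag is true or $\ell\le\ell_t$, set $s^\ell_t$ to a uniformly random point of $Q$ (this execution counts as one forced movement of server $\ell$); else if $s^\ell_{t-1}\notin Q$, set $s^\ell_t$ to a uniformly random point of $Q$ (this counts as one unforced movement of server $\ell$) and set flag $:=$ true; else set $s^\ell_t:=s^\ell_{t-1}$. -}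

module Defs where

open import Data.Nat using (ℕ; zero; suc; _+_; _∸_; _≤_; _<_; _≤ᵇ_; _≤?_)
open import Data.Fin using (Fin)
open import Data.Bool using (Bool; true; false; if_then_else_)
open import Data.Product using (Σ; ∃; _×_)
open import Data.Sum using (_⊎_)
open import Relation.Nullary using (¬_; yes; no)
open import Relation.Binary.PropositionalEquality using (_≡_)

-- Conventions.
--  * U = Fin n (a finite set, uniform metric).
--  * Rounds / time steps are natural numbers 1..T; the input is given by
--    σ : ℕ → Fin n and lv : ℕ → ℕ (values outside 1..T are ignored).
--  * Levels are natural numbers 1..k.
--  * Since ℓ₁ = k, the pattern I_t (over [1,t+1)) is determined by lv:
--    a time r ∈ [1,t] starts a new interval at level i iff i ≤ lv r.
--    Hence an interval of level i of I_t is identified with its start point,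
--    and the interval of level i containing r is the one starting at
--    start lv i r = max { r' ∈ [1,r] : i ≤ lv r' }.

start : (lv : ℕ → ℕ) → ℕ → ℕ → ℕ
start lv i zero = zero
start lv i (suc r) with i ≤? lv (suc r)
... | yes _ = suc r
... | no  _ = start lv i r

count : (ℕ → Bool) → ℕ → ℕ
count p zero = zero
count p (suc T) = (if p (suc T) then 1 else 0) + count p T

numIntervals : (lv : ℕ → ℕ) → ℕ → ℕ → ℕ
numIntervals lv ℓ T = count (λ r → ℓ ≤ᵇ lv r) T

-- A labeling of I_t: level i ↦ (start point of an interval of level i) ↦ point.
Labeling : ℕ → Set
Labeling n = ℕ → ℕ → Fin n

Feasible : {n : ℕ} (k : ℕ) (σ : ℕ → Fin n) (lv : ℕ → ℕ) (t : ℕ) → Labeling n → Set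
Feasible k σ lv t γ =
  ∀ r → 1 ≤ r → r ≤ t →
    ∃ λ i → 1 ≤ i × i ≤ k × γ i (start lv i r) ≡ σ r

ValidInput : {n : ℕ} (k : ℕ) (σ : ℕ → Fin n) (lv : ℕ → ℕ) (T : ℕ) → Set
ValidInput k σ lv T =
  (∀ t → 1 ≤ t → t ≤ T → lv t ≤ k) ×
  (∀ t → 1 ≤ t → t ≤ T → Σ (Labeling _) λ γ → Feasible k σ lv t γ)

-- p ∈ Q^ℓ_t(s(ℓ+1),…,s(k))  (s gives the points p^i for levels i > ℓ)
InQ : {n : ℕ} (k : ℕ) (σ : ℕ → Fin n) (lv : ℕ → ℕ) (t ℓ : ℕ) (s : ℕ → Fin n) → Fin n → Set
InQ k σ lv t ℓ s p =
  Σ (Labeling _) λ γ → Feasible k σ lv t γ ×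
    γ ℓ (start lv ℓ t) ≡ p ×
    (∀ i → ℓ < i → i ≤ k → γ i (start lv i t) ≡ s i)

data Kind : Set where
  forced unforced stay : Kind

isForced : Kind → Bool
isForced forced = true
isForced _      = false

isUnforced : Kind → Bool
isUnforced unforced = true
isUnforced _        = false

-- One round t of algorithm A, processing levels ℓ, ℓ-1, …, 1 with current flag f.
-- old = positions after round t-1, new = positions after round t,
-- kind i = type of execution of server i in round t.
-- "uniformly random point of Q" is modelled as an arbitrary point of Q
-- (every point of Q has positive probability).
data Round {n : ℕ} (k : ℕ) (σ : ℕ → Fin n) (lv : ℕ → ℕ) (t : ℕ)
           (old new : ℕ → Fin n) (kind : ℕ → Kind) : ℕ → Bool → Set where
  done : ∀ {f} → Round k σ lv t old new kind zero f
  forcedStep : ∀ {ℓ f} →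
    (f ≡ true ⊎ suc ℓ ≤ lv t) →
    InQ k σ lv t (suc ℓ) new (new (suc ℓ)) →
    kind (suc ℓ) ≡ forced →
    Round k σ lv t old new kind ℓ f →
    Round k σ lv t old new kind (suc ℓ) f
  unforcedStep : ∀ {ℓ f} →
    f ≡ false → lv t < suc ℓ →
    ¬ InQ k σ lv t (suc ℓ) new (old (suc ℓ)) →
    InQ k σ lv t (suc ℓ) new (new (suc ℓ)) →
    kind (suc ℓ) ≡ unforced →
    Round k σ lv t old new kind ℓ true →
    Round k σ lv t old new kind (suc ℓ) f
  stayStep : ∀ {ℓ f} →
    f ≡ false → lv t < suc ℓ →
    InQ k σ lv t (suc ℓ) new (old (suc ℓ)) →
    new (suc ℓ) ≡ old (suc ℓ) →
    kind (suc ℓ) ≡ stay →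
    Round k σ lv t old new kind ℓ false →
    Round k σ lv t old new kind (suc ℓ) f

-- An execution of A on rounds 1..T: pos t i = position of server i after
-- round t (pos 0 = arbitrary initial configuration), kind t i = what server i did in round t.
Execution : {n : ℕ} (k : ℕ) (σ : ℕ → Fin n) (lv : ℕ → ℕ) (T : ℕ)
            (pos : ℕ → ℕ → Fin n) (kind : ℕ → ℕ → Kind) → Set
Execution k σ lv T pos kind =
  ∀ t → 1 ≤ t → t ≤ T → Round k σ lv t (pos (t ∸ 1)) (pos t) (kind t) k false

forcedMoves : (kind : ℕ → ℕ → Kind) (T ℓ : ℕ) → ℕ
forcedMoves kind T ℓ = count (λ t → isForced (kind t ℓ)) T

unforcedMoves : (kind : ℕ → ℕ → Kind) (T ℓ : ℕ) → ℕ
unforcedMoves kind T ℓ = count (λ t → isUnforced (kind t ℓ)) T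

{-# OPTIONS --safe #-}
-- Within one round, server ℓ is forced only if a new level-ℓ interval starts
-- (ℓ ≤ ℓ_t) or the flag is set when level ℓ is processed.  The flag is raised by
-- an unforced movement and then stays up, so it is set at level ℓ only if server
-- ℓ+1 moved in that round; at level k it is never set, so server k is forced only
-- when ℓ_t = k.  Summing these per-round implications over the rounds gives both
-- inequalities.
module Submission where

open import Defs
open import Data.Nat using (ℕ; zero; suc; _+_; _≤_; _<_; _≤ᵇ_; _≤′_; ≤′-refl; ≤′-step; z≤n; s≤s)
open import Data.Nat.Properties using (≤-refl; ≤-trans; ≤-reflexive; n≤1+n; m≤n+m; m≤n⇒m≤1+n; +-suc; +-monoˡ-≤; +-monoʳ-≤; ≤⇒≤ᵇ; ≤⇒≤′; module ≤-Reasoning)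
open import Data.Fin using (Fin)
open import Data.Bool using (Bool; true; false; _∨_; T; if_then_else_)
open import Data.Unit using (tt)
open import Data.Empty using (⊥-elim)
open import Data.Product using (∃; _×_; _,_; proj₂)
open import Data.Sum using (inj₂)
open import Relation.Binary.PropositionalEquality using (_≡_; sym)

if-+-mono : ∀ {a b : Bool} {m n : ℕ} → (T a → T b) → m ≤ n →
            (if a then 1 else 0) + m ≤ (if b then 1 else 0) + n
if-+-mono {false} {false} _   m≤n = m≤n
if-+-mono {false} {true}  _   m≤n = ≤-trans m≤n (n≤1+n _)
if-+-mono {true}  {true}  _   m≤n = s≤s m≤n
if-+-mono {true}  {false} a⇒b _   = ⊥-elim (a⇒b tt)

count-mono : ∀ {p q : ℕ → Bool} N → (∀ t → 1 ≤ t → t ≤ N → T (p t) → T (q t)) →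
             count p N ≤ count q N
count-mono zero    _   = z≤n
count-mono (suc N) p⇒q =
  if-+-mono (p⇒q (suc N) (s≤s z≤n) ≤-refl)
            (count-mono N (λ t 1≤t t≤N → p⇒q t 1≤t (m≤n⇒m≤1+n t≤N)))

count-∨ : ∀ (p q : ℕ → Bool) N → count (λ t → p t ∨ q t) N ≤ count p N + count q N
count-∨ p q zero = z≤n
count-∨ p q (suc N) with p (suc N) | q (suc N)
... | false | false = count-∨ p q N
... | false | true  = ≤-trans (s≤s (count-∨ p q N)) (≤-reflexive (sym (+-suc (count p N) (count q N))))
... | true  | _     = s≤s (≤-trans (count-∨ p q N) (+-monoʳ-≤ (count p N) (m≤n+m _ _)))

moves : Kind → Bool
moves κ = isForced κ ∨ isUnforced κ

module _ {n k : ℕ} {σ : ℕ → Fin n} {lv : ℕ → ℕ} {t : ℕ}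
         {old new : ℕ → Fin n} {kind : ℕ → Kind} where

  private
    Round′ = Round k σ lv t old new kind

  Round-tail : ∀ {m f} → Round′ (suc m) f → ∃ (Round′ m)
  Round-tail (forcedStep _ _ _ r)       = _ , r
  Round-tail (unforcedStep _ _ _ _ _ r) = _ , r
  Round-tail (stayStep _ _ _ _ _ r)     = _ , r

  Round-restrict : ∀ {j m f} → j ≤′ m → Round′ m f → ∃ (Round′ j)
  Round-restrict ≤′-refl         r = _ , r
  Round-restrict (≤′-step j≤′m) r with Round-tail r
  ... | _ , r′ = Round-restrict j≤′m r′

  forced⇒opensInterval : ∀ {m} → Round′ m false → T (isForced (kind m)) → m ≤ lv t
  forced⇒opensInterval done                                _   = z≤n
  forced⇒opensInterval (forcedStep (inj₂ m≤lv) _ _ _)      _   = m≤lv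
  forced⇒opensInterval (unforcedStep _ _ _ _ κ≡unforced _) isF rewrite κ≡unforced = ⊥-elim isF
  forced⇒opensInterval (stayStep _ _ _ _ κ≡stay _)         isF rewrite κ≡stay     = ⊥-elim isF

  forced⇒movesAbove∨opensInterval : ∀ {m f} → Round′ (suc m) f → T (isForced (kind m)) →
                                     T (moves (kind (suc m)) ∨ (m ≤ᵇ lv t))
  forced⇒movesAbove∨opensInterval (forcedStep _ _ κ≡forced _)         _ rewrite κ≡forced   = tt
  forced⇒movesAbove∨opensInterval (unforcedStep _ _ _ _ κ≡unforced _) _ rewrite κ≡unforced = tt
  forced⇒movesAbove∨opensInterval (stayStep _ _ _ _ κ≡stay r) isF rewrite κ≡stay =
    ≤⇒≤ᵇ (forced⇒opensInterval r isF)

-- The bounds hold for every execution: validity of the input (and ℓ₁ = k) only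
-- ensures that the sets Q are nonempty, i.e. that an execution exists at all.
lemma5 : {n : ℕ} (k : ℕ) (σ : ℕ → Fin n) (lv : ℕ → ℕ) (T : ℕ) →
    ValidInput k σ lv T → lv 1 ≡ k →
    (pos : ℕ → ℕ → Fin n) (kind : ℕ → ℕ → Kind) →
    Execution k σ lv T pos kind →
    (∀ ℓ → 1 ≤ ℓ → ℓ < k →
      forcedMoves kind T ℓ
        ≤ forcedMoves kind T (suc ℓ) + unforcedMoves kind T (suc ℓ) + numIntervals lv ℓ T)
    × forcedMoves kind T k ≤ numIntervals lv k T
lemma5 k σ lv T _ _ pos kind execution = lower , top
  where
  lower : ∀ ℓ → 1 ≤ ℓ → ℓ < k →
    forcedMoves kind T ℓ
      ≤ forcedMoves kind T (suc ℓ) + unforcedMoves kind T (suc ℓ) + numIntervals lv ℓ T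
  lower ℓ _ ℓ<k = begin
    forcedMoves kind T ℓ
      ≤⟨ count-mono T (λ t 1≤t t≤T → forced⇒movesAbove∨opensInterval
                                        (proj₂ (Round-restrict (≤⇒≤′ ℓ<k) (execution t 1≤t t≤T)))) ⟩
    count (λ t → moves (kind t (suc ℓ)) ∨ (ℓ ≤ᵇ lv t)) T
      ≤⟨ count-∨ (λ t → moves (kind t (suc ℓ))) (λ t → ℓ ≤ᵇ lv t) T ⟩
    count (λ t → moves (kind t (suc ℓ))) T + numIntervals lv ℓ T
      ≤⟨ +-monoˡ-≤ (numIntervals lv ℓ T)
           (count-∨ (λ t → isForced (kind t (suc ℓ))) (λ t → isUnforced (kind t (suc ℓ))) T) ⟩
    forcedMoves kind T (suc ℓ) + unforcedMoves kind T (suc ℓ) + numIntervals lv ℓ T ∎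
    where open ≤-Reasoning

  top : forcedMoves kind T k ≤ numIntervals lv k T
  top = count-mono T (λ t 1≤t t≤T isF → ≤⇒≤ᵇ (forced⇒opensInterval (execution t 1≤t t≤T) isF))
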